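{- The edge set of the complete graph $K_9$ cannot be partitioned into three subgraphs each isomorphic to $P_3 \square P_3$.
   Context: $P_n$ denotes the path graph on $n$ vertices. For graphs $G=(V,E)$ and $G'=(V',E')$, the Cartesian product $G \square G'$ has vertex set $V \times V'$, with $(v,v')$ and $(w,w')$ adjacent iff either $\{v,w\}\in E$ and $v'=w'$, or $v=w$ and $\{v',w'\}\in E'$. A partition of $K_m$ into subgraphs means a collection of subgraphs of $K_m$ whose edge sets are pairwise disjoint and together cover all edges of $K_m$. -}

module Defs where

open import Data.Nat using (ℕ; suc)
open import Data.Fin using (Fin; toℕ)
open import Data.Product using (Σ; ∃; _×_; _,_)
open import Data.Sum using (_⊎_)
open import Relation.Binary.PropositionalEquality using (_≡_; _≢_)
open import Relation.Nullary using (¬_)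
open import Function.Definitions using (Injective)

PathAdj : {n : ℕ} → Fin n → Fin n → Set
PathAdj i j = (toℕ j ≡ suc (toℕ i)) ⊎ (toℕ i ≡ suc (toℕ j))

□Adj : {A B : Set} → (A → A → Set) → (B → B → Set) → A × B → A × B → Set
□Adj adjG adjH (v , v′) (w , w′) = (adjG v w × v′ ≡ w′) ⊎ (v ≡ w × adjH v′ w′)

Grid : Set
Grid = Fin 3 × Fin 3

GridAdj : Grid → Grid → Set
GridAdj = □Adj PathAdj PathAdj

-- A subgraph of K_m isomorphic to P₃ □ P₃ is the image of an injective
-- vertex map Grid → Fin m (edges are the images of the grid edges).
record GridCopy (m : ℕ) : Set where
  field
    emb : Grid → Fin m
    inj : Injective _≡_ _≡_ emb

open GridCopy public

HasEdge : {m : ℕ} → GridCopy m → Fin m → Fin m → Set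
HasEdge C u v = ∃ λ p → ∃ λ q → GridAdj p q × emb C p ≡ u × emb C q ≡ v

IsEdgePartition : {m k : ℕ} → (Fin k → GridCopy m) → Set
IsEdgePartition {m} {k} C =
  ((u v : Fin m) → u ≢ v → ∃ λ i → HasEdge (C i) u v)
  × ((i j : Fin k) (u v : Fin m) → HasEdge (C i) u v → HasEdge (C j) u v → i ≡ j)

{-# OPTIONS --safe #-}
-- Each copy of P₃ □ P₃ is bipartite (colour (i , j) by the parity of i + j),
-- and its 2-colouring extends to all of K₉. Recording for each vertex of K₉
-- its colour in the three copies gives at most 2³ = 8 patterns, so two of the
-- nine vertices share a pattern; the edge between them lies in some copy,
-- whose colouring is proper: contradiction.
module Submission where

open import Defs
open import Data.Fin using (Fin; toℕ; funToFin; finToFun; _≟_)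
open import Data.Fin.Patterns using (0F; 1F)
open import Data.Fin.Properties using (pigeonhole; any?; <⇒≢; finToFun-funToFin)
open import Data.Nat using (ℕ; suc; _≤_; _^_; parity)
open import Data.Nat.Properties using (≮⇒≥; <⇒≱; n<1+n)
open import Data.Parity using (Parity; 0ℙ; 1ℙ; _+_)
open import Data.Parity.Properties using (p≢p⁻¹; suc-homo-⁻¹; +-cancelʳ-≡; +-cancelˡ-≡)
open import Data.Product using (Σ; ∃; _×_; _,_)
open import Data.Sum using (inj₁; inj₂)
open import Function using (_∘_)
open import Function.Definitions using (Injective)
open import Relation.Binary.PropositionalEquality
open import Relation.Nullary using (¬_; Dec; yes; no; contradiction)
open import Relation.Nullary.Decidable using (map′)

ProperColouring : {V C : Set} → (V → V → Set) → (V → C) → Set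
ProperColouring adj c = ∀ x y → adj x y → c x ≢ c y

separating-colourings-≤ : ∀ {k m r} (c : Fin k → Fin m → Fin r) →
                          (∀ {u v} → u ≢ v → ∃ λ i → c i u ≢ c i v) →
                          m ≤ r ^ k
separating-colourings-≤ {k} {m} {r} c separates = ≮⇒≥ λ rᵏ<m →
  let u , v , u<v , sameColours = pigeonhole rᵏ<m (funToFin ∘ colours)
      i , differ = separates (<⇒≢ u<v)
  in differ (begin
    c i u                                ≡⟨ finToFun-funToFin (colours u) i ⟨
    finToFun (funToFin (colours u)) i    ≡⟨ cong (λ x → finToFun x i) sameColours ⟩
    finToFun (funToFin (colours v)) i    ≡⟨ finToFun-funToFin (colours v) i ⟩
    c i v                                ∎)
  where
  open ≡-Reasoning
  colours : Fin m → Fin k → Fin r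
  colours v i = c i v

parity≢parity-suc : ∀ n → parity n ≢ parity (suc n)
parity≢parity-suc n eq = p≢p⁻¹ (parity (suc n)) (trans (sym eq) (sym (suc-homo-⁻¹ n)))

pathColouring : {n : ℕ} → Fin n → Parity
pathColouring = parity ∘ toℕ

pathColouring-proper : {n : ℕ} → ProperColouring (PathAdj {n}) pathColouring
pathColouring-proper i _ (inj₁ j≡1+i) rewrite j≡1+i = parity≢parity-suc (toℕ i)
pathColouring-proper _ j (inj₂ i≡1+j) rewrite i≡1+j = parity≢parity-suc (toℕ j) ∘ sym

□-colouring : {V W : Set} → (V → Parity) → (W → Parity) → V × W → Parity
□-colouring c d (v , w) = c v + d w

□-colouring-proper : {V W : Set} {adjV : V → V → Set} {adjW : W → W → Set}
                     {c : V → Parity} {d : W → Parity} →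
                     ProperColouring adjV c → ProperColouring adjW d →
                     ProperColouring (□Adj adjV adjW) (□-colouring c d)
□-colouring-proper c-proper d-proper (v , _) (v′ , _) (inj₁ (adj , refl)) =
  c-proper v v′ adj ∘ +-cancelʳ-≡ _ _ _
□-colouring-proper {c = c} c-proper d-proper (v , w) (_ , w′) (inj₂ (refl , adj)) =
  d-proper w w′ adj ∘ +-cancelˡ-≡ (c v) _ _

gridColouring : Grid → Parity
gridColouring = □-colouring pathColouring pathColouring

gridColouring-proper : ProperColouring GridAdj gridColouring
gridColouring-proper = □-colouring-proper pathColouring-proper pathColouring-proper

module _ {m : ℕ} (C : GridCopy m) where

  preimage? : (v : Fin m) → Dec (∃ λ p → emb C p ≡ v)
  preimage? v = map′ (λ (a , b , e) → (a , b) , e) (λ ((a , b) , e) → a , b , e)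
                     (any? λ a → any? λ b → emb C (a , b) ≟ v)

  copyColouring : Fin m → Parity
  copyColouring v with preimage? v
  ... | yes (p , _) = gridColouring p
  ... | no _        = 0ℙ

  copyColouring-emb : ∀ p → copyColouring (emb C p) ≡ gridColouring p
  copyColouring-emb p with preimage? (emb C p)
  ... | yes (q , eq) = cong gridColouring (inj C eq)
  ... | no ∄p        = contradiction (p , refl) ∄p

  copyColouring-proper : ProperColouring (HasEdge C) copyColouring
  copyColouring-proper _ _ (p , q , adj , refl , refl)
    rewrite copyColouring-emb p | copyColouring-emb q =
    gridColouring-proper p q adj

parityToFin : Parity → Fin 2
parityToFin 0ℙ = 0F
parityToFin 1ℙ = 1F

parityToFin-injective : Injective _≡_ _≡_ parityToFin
parityToFin-injective {0ℙ} {0ℙ} _ = refl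
parityToFin-injective {1ℙ} {1ℙ} _ = refl

theorem3 : ¬ (Σ (Fin 3 → GridCopy 9) IsEdgePartition)
theorem3 (C , covers , _) = <⇒≱ (n<1+n 8) (separating-colourings-≤ colouring separates)
  where
  colouring : Fin 3 → Fin 9 → Fin 2
  colouring i = parityToFin ∘ copyColouring (C i)

  separates : ∀ {u v} → u ≢ v → ∃ λ i → colouring i u ≢ colouring i v
  separates u≢v with i , edge ← covers _ _ u≢v =
    i , copyColouring-proper (C i) _ _ edge ∘ parityToFin-injective
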